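{- Let $p\ge 1$ be an integer and let $G$ be a finite simple graph with at least one edge such that $\gamma_p(G)>p$. If the maximum degree satisfies $\Delta(G)<p$, then $r_p(G)=p-\Delta(G)$.
   Context: For a graph $G=(V,E)$, a set $D\subseteq V$ is a $p$-dominating set if every vertex $x\notin D$ has at least $p$ neighbours in $D$; $\gamma_p(G)$ is the minimum size of a $p$-dominating set. For $B\subseteq E(G^c)$ (edges of the complement), $G+B=(V,E\cup B)$. The $p$-reinforcement number is $r_p(G)=\min\{|B| : B\subseteq E(G^c),\ \gamma_p(G+B)<\gamma_p(G)\}$, with the convention $r_p(G)=0$ if $\gamma_p(G)\le p$. -}

module Defs where

open import Data.Bool using (Bool; true; false; _∨_; _∧_; if_then_else_)
open import Data.Bool.Properties using (∨-comm)
open import Data.Nat using (ℕ; _≤_; _<_; _<ᵇ_)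
open import Data.Fin using (Fin; toℕ)
open import Data.Fin.Subset using (Subset; _∈_; _∉_; _∩_; ∣_∣)
open import Data.Vec using (tabulate)
open import Data.List using (List; map; allFin)
open import Data.Nat.ListAction using (sum)
open import Data.Product using (Σ; ∃; ∃-syntax; _×_; _,_)
open import Relation.Binary.PropositionalEquality using (_≡_; refl; cong₂)

record SimpleGraph (n : ℕ) : Set where
  field
    adj    : Fin n → Fin n → Bool
    sym    : ∀ i j → adj i j ≡ adj j i
    irrefl : ∀ i → adj i i ≡ false
open SimpleGraph public

module _ {n : ℕ} where

  N : SimpleGraph n → Fin n → Subset n
  N G x = tabulate (λ y → adj G x y)

  deg : SimpleGraph n → Fin n → ℕ
  deg G x = ∣ N G x ∣

  IsMaxDegree : SimpleGraph n → ℕ → Set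
  IsMaxDegree G d = (∃[ v ] deg G v ≡ d) × (∀ v → deg G v ≤ d)

  HasEdge : SimpleGraph n → Set
  HasEdge G = ∃[ i ] ∃[ j ] adj G i j ≡ true

  private
    b2n : Bool → ℕ
    b2n true  = 1
    b2n false = 0

  -- number of edges: unordered pairs {i,j} (counted once via toℕ i < toℕ j)
  edgeCount : SimpleGraph n → ℕ
  edgeCount G =
    sum (map (λ i → sum (map (λ j → b2n ((toℕ i <ᵇ toℕ j) ∧ adj G i j)) (allFin n))) (allFin n))

  IsPDominating : SimpleGraph n → ℕ → Subset n → Set
  IsPDominating G p D = ∀ x → x ∉ D → p ≤ ∣ D ∩ N G x ∣

  IsGammaP : SimpleGraph n → ℕ → ℕ → Set
  IsGammaP G p k =
    (∃[ D ] IsPDominating G p D × ∣ D ∣ ≡ k) ×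
    (∀ D → IsPDominating G p D → k ≤ ∣ D ∣)

  InComplement : SimpleGraph n → SimpleGraph n → Set
  InComplement G B = ∀ i j → adj B i j ≡ true → adj G i j ≡ false

  _+E_ : SimpleGraph n → SimpleGraph n → SimpleGraph n
  G +E B = record
    { adj    = λ i j → adj G i j ∨ adj B i j
    ; sym    = λ i j → cong₂ _∨_ (sym G i j) (sym B i j)
    ; irrefl = λ i → cong₂ _∨_ (irrefl G i) (irrefl B i) }

  ReducesGammaP : SimpleGraph n → ℕ → SimpleGraph n → Set
  ReducesGammaP G p B =
    ∃[ g ] ∃[ g' ] IsGammaP G p g × IsGammaP (G +E B) p g' × g' < g

  -- r_p(G) = k  (case γ_p(G) > p; the convention r_p = 0 is not used)
  IsReinforcementP : SimpleGraph n → ℕ → ℕ → Set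
  IsReinforcementP G p k =
    (∃[ B ] InComplement G B × ReducesGammaP G p B × edgeCount B ≡ k) ×
    (∀ B → InComplement G B → ReducesGammaP G p B → k ≤ edgeCount B)

-- Since every degree is below p, no vertex outside a set D can have p
-- neighbours in D, so the only p-dominating set of G is V and γ_p(G) = n.
--
-- If γ_p(G + B) < n, a minimum p-dominating set of G + B misses
-- some vertex x, and then  p ≤ deg_{G+B}(x) ≤ deg_G(x) + deg_B(x) ≤ Δ + |E(B)|,
-- because a vertex of B has at most |E(B)| incident edges.
--
-- Let v have degree Δ.  Since n = γ_p(G) > p, v has at least
-- p − Δ non-neighbours other than itself; the star B joining v to p − Δ of
-- them has p − Δ edges, and in G + B the vertex v has degree p, so V ∖ {v}
-- is p-dominating and γ_p(G + B) ≤ n − 1.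

module Submission where

open import Defs hiding (sym)
open SimpleGraph using () renaming (sym to adj-sym)
open import Data.Bool using (Bool; true; false; _∧_; _∨_)
open import Data.Bool.Properties using (∧-zeroʳ; ∧-identityʳ; ∨-identityʳ; ∨-comm; ¬-not)
open import Data.Nat using (ℕ; zero; suc; _+_; _∸_; _≤_; _<_; _<ᵇ_; z≤n; s≤s; _≤?_; _<?_)
open import Data.Nat.Properties
  using (+-0-commutativeMonoid; +-mono-≤; +-monoʳ-≤; +-identityʳ; +-suc; +-comm; m≤m+n; m≤n+m;
         ≤-refl; ≤-reflexive; ≤-trans; ≤-antisym; ≤-<-trans; <-≤-trans; <⇒≤; <⇒≱; ≮⇒≥; n≮0;
         ≤-pred; m≤n+o⇒m∸n≤o; m+n≤o⇒m≤o∸n; m+[n∸m]≡n; module ≤-Reasoning)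
open import Data.Fin using (Fin; zero; suc; toℕ; punchIn; _≟_)
open import Data.Fin.Properties using (toℕ-injective; punchInᵢ≢i; all?; ¬∀⟶∃¬)
open import Data.Fin.Subset using (Subset; _∈_; _∉_; _⊆_; _∩_; _∪_; ∁; ⁅_⁆; _-_; ⊤; ⊥; ∣_∣; Empty)
open import Data.Fin.Subset.Properties
  using (_∈?_; anySubset?; ∈⊤; ∣⊤∣≡n; ⊥⊆; ∣⊥∣≡0; ∣⁅x⁆∣≡1; x∈⁅x⁆; s⊆s;
         p⊆q⇒∣p∣≤∣q∣; ∣p∩q∣≤∣q∣; x∈p∩q⁺; x∈p∩q⁻; x∈p∪q⁺; Empty-unique; x∈∁p⇒x∉p;
         ∣∁p∣≡n∸∣p∣; x∈p∧x≢y⇒x∈p-y; x∈p⇒∣p-x∣<∣p∣)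
open import Data.Vec using ([]; _∷_; lookup; tabulate)
open import Data.Vec.Properties using (lookup∘tabulate; tabulate∘lookup; tabulate-cong; lookup-zipWith; lookup⇒[]=; []=⇒lookup)
import Data.List as List
open import Data.List.Properties using (map-tabulate)
open import Data.Nat.ListAction using () renaming (sum to listSum)
open import Algebra.Properties.CommutativeMonoid.Sum +-0-commutativeMonoid
  using (sum; sum-remove; sum-cong-≗; sum-replicate-zero; ∑-distrib-+)
open import Data.Product using (Σ; ∃-syntax; _×_; _,_; proj₁; proj₂)
open import Data.Sum using (_⊎_; inj₁; inj₂)
open import Relation.Nullary using (Dec; yes; no; does; ¬?; contradiction)
open import Relation.Nullary.Decidable using (_→-dec_; _×-dec_)
open import Relation.Binary.PropositionalEquality
  using (_≡_; _≢_; refl; sym; trans; cong; cong₂; subst; subst₂; ≢-sym; module ≡-Reasoning)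
open import Function using (id; _∘_)

bit : Bool → ℕ
bit true  = 1
bit false = 0

sum-mono-≤ : ∀ {n} {f g : Fin n → ℕ} → (∀ i → f i ≤ g i) → sum f ≤ sum g
sum-mono-≤ {zero}  f≤g = z≤n
sum-mono-≤ {suc n} f≤g = +-mono-≤ (f≤g zero) (sum-mono-≤ (f≤g ∘ suc))

term≤sum : ∀ {n} (f : Fin n → ℕ) i → f i ≤ sum f
term≤sum {suc n} f i = ≤-trans (m≤m+n (f i) _) (≤-reflexive (sym (sum-remove {i = i} f)))

sum-supported : ∀ {n} (f : Fin n → ℕ) i → (∀ j → j ≢ i → f j ≡ 0) → sum f ≡ f i
sum-supported {suc n} f i vanish = begin
  sum f                      ≡⟨ sum-remove {i = i} f ⟩
  f i + sum (f ∘ punchIn i)  ≡⟨ cong (f i +_) restVanishes ⟩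
  f i + 0                    ≡⟨ +-identityʳ (f i) ⟩
  f i                        ∎
  where
  open ≡-Reasoning
  restVanishes : sum (f ∘ punchIn i) ≡ 0
  restVanishes = trans (sum-cong-≗ (λ j → vanish (punchIn i j) (punchInᵢ≢i i j)))
                       (sum-replicate-zero n)

-- For a matrix m with m x x = 0, the entries of row x and of column x are
-- distinct entries of m, so together they are at most the total.
row+column≤total : ∀ {n} (m : Fin n → Fin n → ℕ) x → m x x ≡ 0 →
  sum (m x) + sum (λ i → m i x) ≤ sum (λ i → sum (m i))
row+column≤total {suc n} m x diagonal = begin
  sum (m x) + sum (λ i → m i x)
    ≡⟨ cong (sum (m x) +_) (sum-remove {i = x} (λ i → m i x)) ⟩
  sum (m x) + (m x x + sum (λ i → m (punchIn x i) x))
    ≡⟨ cong (λ d → sum (m x) + (d + sum (λ i → m (punchIn x i) x))) diagonal ⟩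
  sum (m x) + sum (λ i → m (punchIn x i) x)
    ≤⟨ +-monoʳ-≤ (sum (m x)) (sum-mono-≤ (λ i → term≤sum (m (punchIn x i)) x)) ⟩
  sum (m x) + sum (λ i → sum (m (punchIn x i)))
    ≡⟨ sym (sum-remove {i = x} (λ i → sum (m i))) ⟩
  sum (λ i → sum (m i)) ∎
  where open ≤-Reasoning

total≤row+column : ∀ {n} (m : Fin n → Fin n → ℕ) x →
  (∀ i j → i ≢ x → j ≢ x → m i j ≡ 0) →
  sum (λ i → sum (m i)) ≤ sum (m x) + sum (λ i → m i x)
total≤row+column {suc n} m x offCross = begin
  sum (λ i → sum (m i))
    ≡⟨ sum-remove {i = x} (λ i → sum (m i)) ⟩
  sum (m x) + sum (λ i → sum (m (punchIn x i)))
    ≡⟨ cong (sum (m x) +_) (sum-cong-≗ otherRow) ⟩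
  sum (m x) + sum (λ i → m (punchIn x i) x)
    ≤⟨ +-monoʳ-≤ (sum (m x)) (m≤n+m _ (m x x)) ⟩
  sum (m x) + (m x x + sum (λ i → m (punchIn x i) x))
    ≡⟨ cong (sum (m x) +_) (sym (sum-remove {i = x} (λ i → m i x))) ⟩
  sum (m x) + sum (λ i → m i x) ∎
  where
  open ≤-Reasoning
  otherRow : ∀ i → sum (m (punchIn x i)) ≡ m (punchIn x i) x
  otherRow i = sum-supported (m (punchIn x i)) x
                 (λ j → offCross (punchIn x i) j (punchInᵢ≢i x i))

∣∣≡sum : ∀ {n} (p : Subset n) → ∣ p ∣ ≡ sum (bit ∘ lookup p)
∣∣≡sum []          = refl
∣∣≡sum (true ∷ p)  = cong suc (∣∣≡sum p)
∣∣≡sum (false ∷ p) = ∣∣≡sum p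

adjacent⇒distinct : ∀ {n} (H : SimpleGraph n) {x y} → adj H x y ≡ true → x ≢ y
adjacent⇒distinct H {x} xy refl = contradiction (trans (sym xy) (irrefl H x)) λ ()

exactly-one-<ᵇ : ∀ m n → m ≢ n → bit (m <ᵇ n) + bit (n <ᵇ m) ≡ 1
exactly-one-<ᵇ zero    zero    m≢n = contradiction refl m≢n
exactly-one-<ᵇ zero    (suc n) _   = refl
exactly-one-<ᵇ (suc m) zero    _   = refl
exactly-one-<ᵇ (suc m) (suc n) m≢n = exactly-one-<ᵇ m n (m≢n ∘ cong suc)

-- forwardEdge H i j is 1 iff ij is an edge with i < j: the edge matrix in
-- which each edge is recorded once, at its smaller end.
forwardEdge : ∀ {n} → SimpleGraph n → Fin n → Fin n → ℕ
forwardEdge H i j = bit ((toℕ i <ᵇ toℕ j) ∧ adj H i j)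

forwardEdge-absent : ∀ {n} (H : SimpleGraph n) {i j} → adj H i j ≡ false → forwardEdge H i j ≡ 0
forwardEdge-absent H {i} {j} ij = cong bit (trans (cong ((toℕ i <ᵇ toℕ j) ∧_) ij) (∧-zeroʳ _))

-- Defs does not export its 0/1 indicator; the summand of edgeCount is
-- recovered by unification and identified with forwardEdge by evaluation.
edgeSummand : Σ ({n : ℕ} → SimpleGraph n → Fin n → Fin n → ℕ) λ e →
  ∀ {n} (H : SimpleGraph n) →
  edgeCount H ≡ listSum (List.map (λ i → listSum (List.map (e H i) (List.allFin n))) (List.allFin n))
edgeSummand = _ , λ H → refl

edgeSummand≡forwardEdge : ∀ {n} (H : SimpleGraph n) i j → proj₁ edgeSummand H i j ≡ forwardEdge H i j
edgeSummand≡forwardEdge H i j with (toℕ i <ᵇ toℕ j) ∧ adj H i j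
... | true  = refl
... | false = refl

listSum-allFin : ∀ {n} (f : Fin n → ℕ) → listSum (List.map f (List.allFin n)) ≡ sum f
listSum-allFin f = trans (cong listSum (map-tabulate id f)) (listSum-tabulate f)
  where
  listSum-tabulate : ∀ {n} (f : Fin n → ℕ) → listSum (List.tabulate f) ≡ sum f
  listSum-tabulate {zero}  f = refl
  listSum-tabulate {suc n} f = cong (f zero +_) (listSum-tabulate (f ∘ suc))

edgeCount≡total : ∀ {n} (H : SimpleGraph n) → edgeCount H ≡ sum (λ i → sum (forwardEdge H i))
edgeCount≡total {n} H = begin
  edgeCount H
    ≡⟨ proj₂ edgeSummand H ⟩
  listSum (List.map row (List.allFin n))
    ≡⟨ listSum-allFin row ⟩
  sum row
    ≡⟨ sum-cong-≗ (λ i → trans (listSum-allFin (e H i)) (sum-cong-≗ (edgeSummand≡forwardEdge H i))) ⟩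
  sum (λ i → sum (forwardEdge H i)) ∎
  where
  open ≡-Reasoning
  e = proj₁ edgeSummand
  row : Fin n → ℕ
  row i = listSum (List.map (e H i) (List.allFin n))

bit-split : ∀ a b c → (c ≡ true → bit a + bit b ≡ 1) → bit c ≡ bit (a ∧ c) + bit (b ∧ c)
bit-split a b false _    = sym (cong₂ _+_ (cong bit (∧-zeroʳ a)) (cong bit (∧-zeroʳ b)))
bit-split a b true  once =
  sym (trans (cong₂ _+_ (cong bit (∧-identityʳ a)) (cong bit (∧-identityʳ b))) (once refl))

adjacency-split : ∀ {n} (H : SimpleGraph n) x j →
  bit (adj H x j) ≡ forwardEdge H x j + forwardEdge H j x
adjacency-split H x j = begin
  bit (adj H x j)
    ≡⟨ bit-split (toℕ x <ᵇ toℕ j) (toℕ j <ᵇ toℕ x) (adj H x j) once ⟩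
  forwardEdge H x j + bit ((toℕ j <ᵇ toℕ x) ∧ adj H x j)
    ≡⟨ cong (λ c → forwardEdge H x j + bit ((toℕ j <ᵇ toℕ x) ∧ c)) (adj-sym H x j) ⟩
  forwardEdge H x j + forwardEdge H j x ∎
  where
  open ≡-Reasoning
  once : adj H x j ≡ true → bit (toℕ x <ᵇ toℕ j) + bit (toℕ j <ᵇ toℕ x) ≡ 1
  once xj = exactly-one-<ᵇ (toℕ x) (toℕ j) (adjacent⇒distinct H xj ∘ toℕ-injective)

deg≡row+column : ∀ {n} (H : SimpleGraph n) x →
  deg H x ≡ sum (forwardEdge H x) + sum (λ i → forwardEdge H i x)
deg≡row+column H x = begin
  deg H x                                   ≡⟨ ∣∣≡sum (N H x) ⟩
  sum (bit ∘ lookup (N H x))                ≡⟨ sum-cong-≗ (λ j → cong bit (lookup∘tabulate (adj H x) j)) ⟩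
  sum (bit ∘ adj H x)                       ≡⟨ sum-cong-≗ (adjacency-split H x) ⟩
  sum (λ j → forwardEdge H x j + forwardEdge H j x)
                                            ≡⟨ ∑-distrib-+ (forwardEdge H x) (λ j → forwardEdge H j x) ⟩
  sum (forwardEdge H x) + sum (λ i → forwardEdge H i x) ∎
  where open ≡-Reasoning

deg≤edgeCount : ∀ {n} (H : SimpleGraph n) x → deg H x ≤ edgeCount H
deg≤edgeCount H x = begin
  deg H x
    ≡⟨ deg≡row+column H x ⟩
  sum (forwardEdge H x) + sum (λ i → forwardEdge H i x)
    ≤⟨ row+column≤total (forwardEdge H) x (forwardEdge-absent H (irrefl H x)) ⟩
  sum (λ i → sum (forwardEdge H i))
    ≡⟨ sym (edgeCount≡total H) ⟩
  edgeCount H ∎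
  where open ≤-Reasoning

edgeCount-star : ∀ {n} (H : SimpleGraph n) x →
  (∀ i j → adj H i j ≡ true → i ≡ x ⊎ j ≡ x) → edgeCount H ≡ deg H x
edgeCount-star H x centred = ≤-antisym atMostDeg (deg≤edgeCount H x)
  where
  open ≤-Reasoning
  offCross : ∀ i j → i ≢ x → j ≢ x → forwardEdge H i j ≡ 0
  offCross i j i≢x j≢x = forwardEdge-absent H (¬-not noEdge)
    where
    noEdge : adj H i j ≢ true
    noEdge ij with centred i j ij
    ... | inj₁ i≡x = i≢x i≡x
    ... | inj₂ j≡x = j≢x j≡x
  atMostDeg : edgeCount H ≤ deg H x
  atMostDeg = begin
    edgeCount H                                            ≡⟨ edgeCount≡total H ⟩
    sum (λ i → sum (forwardEdge H i))                      ≤⟨ total≤row+column (forwardEdge H) x offCross ⟩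
    sum (forwardEdge H x) + sum (λ i → forwardEdge H i x)  ≡⟨ sym (deg≡row+column H x) ⟩
    deg H x                                                ∎

∣p∪q∣+∣p∩q∣≡∣p∣+∣q∣ : ∀ {n} (p q : Subset n) → ∣ p ∪ q ∣ + ∣ p ∩ q ∣ ≡ ∣ p ∣ + ∣ q ∣
∣p∪q∣+∣p∩q∣≡∣p∣+∣q∣ [] [] = refl
∣p∪q∣+∣p∩q∣≡∣p∣+∣q∣ (true ∷ p) (true ∷ q) =
  cong suc (trans (+-suc ∣ p ∪ q ∣ ∣ p ∩ q ∣)
           (trans (cong suc (∣p∪q∣+∣p∩q∣≡∣p∣+∣q∣ p q)) (sym (+-suc ∣ p ∣ ∣ q ∣))))
∣p∪q∣+∣p∩q∣≡∣p∣+∣q∣ (true ∷ p) (false ∷ q) = cong suc (∣p∪q∣+∣p∩q∣≡∣p∣+∣q∣ p q)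
∣p∪q∣+∣p∩q∣≡∣p∣+∣q∣ (false ∷ p) (true ∷ q) =
  trans (cong suc (∣p∪q∣+∣p∩q∣≡∣p∣+∣q∣ p q)) (sym (+-suc ∣ p ∣ ∣ q ∣))
∣p∪q∣+∣p∩q∣≡∣p∣+∣q∣ (false ∷ p) (false ∷ q) = ∣p∪q∣+∣p∩q∣≡∣p∣+∣q∣ p q

∣p∪q∣≤∣p∣+∣q∣ : ∀ {n} (p q : Subset n) → ∣ p ∪ q ∣ ≤ ∣ p ∣ + ∣ q ∣
∣p∪q∣≤∣p∣+∣q∣ p q = ≤-trans (m≤m+n ∣ p ∪ q ∣ ∣ p ∩ q ∣) (≤-reflexive (∣p∪q∣+∣p∩q∣≡∣p∣+∣q∣ p q))

∣p∪q∣≡∣p∣+∣q∣ : ∀ {n} (p q : Subset n) → Empty (p ∩ q) → ∣ p ∪ q ∣ ≡ ∣ p ∣ + ∣ q ∣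
∣p∪q∣≡∣p∣+∣q∣ {n} p q disjoint = begin
  ∣ p ∪ q ∣                ≡⟨ sym (+-identityʳ ∣ p ∪ q ∣) ⟩
  ∣ p ∪ q ∣ + 0            ≡⟨ cong (∣ p ∪ q ∣ +_) (sym (trans (cong ∣_∣ (Empty-unique disjoint)) (∣⊥∣≡0 n))) ⟩
  ∣ p ∪ q ∣ + ∣ p ∩ q ∣    ≡⟨ ∣p∪q∣+∣p∩q∣≡∣p∣+∣q∣ p q ⟩
  ∣ p ∣ + ∣ q ∣            ∎
  where open ≡-Reasoning

subset-of-size : ∀ {n} k (T : Subset n) → k ≤ ∣ T ∣ → ∃[ S ] S ⊆ T × ∣ S ∣ ≡ k
subset-of-size {n} zero T _ = ⊥ , ⊥⊆ , ∣⊥∣≡0 n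
subset-of-size (suc k) (true ∷ T) (s≤s k≤∣T∣) with subset-of-size k T k≤∣T∣
... | S , S⊆T , ∣S∣≡k = true ∷ S , s⊆s S⊆T , cong suc ∣S∣≡k
subset-of-size (suc k) (false ∷ T) k≤∣T∣ with subset-of-size (suc k) T k≤∣T∣
... | S , S⊆T , ∣S∣≡k = false ∷ S , s⊆s S⊆T , ∣S∣≡k

missing-vertex : ∀ {n} (D : Subset n) → ∣ D ∣ < n → ∃[ x ] x ∉ D
missing-vertex {n} D ∣D∣<n = ¬∀⟶∃¬ n (_∈ D) (_∈? D) λ everywhere →
  <⇒≱ ∣D∣<n (subst (_≤ ∣ D ∣) (∣⊤∣≡n n) (p⊆q⇒∣p∣≤∣q∣ {p = ⊤} (λ {x} _ → everywhere x)))

minimum-size : ∀ {n} (P : Subset n → Set) → (∀ D → Dec (P D)) → ∀ D → P D →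
  ∃[ k ] (∃[ D ] P D × ∣ D ∣ ≡ k) × (∀ D → P D → k ≤ ∣ D ∣)
minimum-size P P? D₀ pD₀ = descend ∣ D₀ ∣ D₀ pD₀ ≤-refl
  where
  descend : ∀ bound D → P D → ∣ D ∣ ≤ bound →
    ∃[ k ] (∃[ D ] P D × ∣ D ∣ ≡ k) × (∀ D → P D → k ≤ ∣ D ∣)
  descend bound D pD ∣D∣≤bound with anySubset? (λ E → P? E ×-dec (∣ E ∣ <? ∣ D ∣))
  ... | no noSmaller = ∣ D ∣ , (D , pD , refl) , λ E pE → ≮⇒≥ (λ smaller → noSmaller (E , pE , smaller))
  descend zero      D pD ∣D∣≤0 | yes (E , pE , smaller) = contradiction (<-≤-trans smaller ∣D∣≤0) n≮0
  descend (suc bound) D pD ∣D∣≤bound | yes (E , pE , smaller) =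
    descend bound E pE (≤-pred (≤-trans smaller ∣D∣≤bound))

adjacent⇒∈N : ∀ {n} (H : SimpleGraph n) {x y} → adj H x y ≡ true → y ∈ N H x
adjacent⇒∈N H {x} {y} xy = lookup⇒[]= y (N H x) (trans (lookup∘tabulate (adj H x) y) xy)

∈N⇒adjacent : ∀ {n} (H : SimpleGraph n) {x y} → y ∈ N H x → adj H x y ≡ true
∈N⇒adjacent H {x} {y} y∈N = trans (sym (lookup∘tabulate (adj H x) y)) ([]=⇒lookup y∈N)

∉N⇒nonadjacent : ∀ {n} (H : SimpleGraph n) {x y} → y ∉ N H x → adj H x y ≡ false
∉N⇒nonadjacent H y∉N = ¬-not (y∉N ∘ adjacent⇒∈N H)

N-+E : ∀ {n} (G B : SimpleGraph n) x → N (G +E B) x ≡ N G x ∪ N B x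
N-+E G B x = sym (trans (sym (tabulate∘lookup (N G x ∪ N B x))) (tabulate-cong entries))
  where
  entries : ∀ j → lookup (N G x ∪ N B x) j ≡ (adj G x j ∨ adj B x j)
  entries j = trans (lookup-zipWith _∨_ j (N G x) (N B x))
                    (cong₂ _∨_ (lookup∘tabulate (adj G x) j) (lookup∘tabulate (adj B x) j))

deg-+E : ∀ {n} (G B : SimpleGraph n) x → deg (G +E B) x ≤ deg G x + deg B x
deg-+E G B x = subst (λ U → ∣ U ∣ ≤ deg G x + deg B x) (sym (N-+E G B x)) (∣p∪q∣≤∣p∣+∣q∣ (N G x) (N B x))

deg≤∣D∩N∣ : ∀ {n} (H : SimpleGraph n) x (D : Subset n) → (∀ y → y ≢ x → y ∈ D) →
  deg H x ≤ ∣ D ∩ N H x ∣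
deg≤∣D∩N∣ H x D covers = p⊆q⇒∣p∣≤∣q∣ λ {y} y∈N →
  x∈p∩q⁺ (covers y (≢-sym (adjacent⇒distinct H (∈N⇒adjacent H y∈N))) , y∈N)

-- p-domination is decidable, so γ_p exists: V itself is p-dominating.
dominating? : ∀ {n} (H : SimpleGraph n) p D → Dec (IsPDominating H p D)
dominating? H p D = all? (λ x → ¬? (x ∈? D) →-dec (p ≤? ∣ D ∩ N H x ∣))

⊤-dominating : ∀ {n} (H : SimpleGraph n) p → IsPDominating H p ⊤
⊤-dominating H p x x∉⊤ = contradiction ∈⊤ x∉⊤

γ-exists : ∀ {n} (H : SimpleGraph n) p → ∃[ g ] IsGammaP H p g
γ-exists H p = minimum-size (IsPDominating H p) (dominating? H p) ⊤ (⊤-dominating H p)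

γ≤n : ∀ {n} (H : SimpleGraph n) {p g} → IsGammaP H p g → g ≤ n
γ≤n {n} H {p} (_ , minimal) = subst (_ ≤_) (∣⊤∣≡n n) (minimal ⊤ (⊤-dominating H p))

γ-low-degree : ∀ {n} (G : SimpleGraph n) {p g} → (∀ x → deg G x < p) → IsGammaP G p g → g ≡ n
γ-low-degree {n} G {p} low γ@((D , dominating , ∣D∣≡g) , _) = ≤-antisym (γ≤n G γ) n≤g
  where
  full : ∀ x → x ∈ D
  full x with x ∈? D
  ... | yes x∈D = x∈D
  ... | no  x∉D = contradiction (≤-trans (dominating x x∉D) (∣p∩q∣≤∣q∣ D (N G x))) (<⇒≱ (low x))
  n≤g : n ≤ _
  n≤g = subst₂ _≤_ (∣⊤∣≡n n) ∣D∣≡g (p⊆q⇒∣p∣≤∣q∣ {p = ⊤} (λ {x} _ → full x))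

punctured-dominating : ∀ {n} (H : SimpleGraph n) {p} v → p ≤ deg H v → IsPDominating H p (⊤ - v)
punctured-dominating H v p≤deg x x∉ with x ≟ v
... | yes refl = ≤-trans p≤deg (deg≤∣D∩N∣ H x (⊤ - x) (λ y y≢x → x∈p∧x≢y⇒x∈p-y ∈⊤ y≢x))
... | no  x≢v  = contradiction (x∈p∧x≢y⇒x∈p-y ∈⊤ x≢v) x∉

∣⊤-v∣<n : ∀ {n} (v : Fin n) → ∣ ⊤ - v ∣ < n
∣⊤-v∣<n {n} v = subst (∣ ⊤ - v ∣ <_) (∣⊤∣≡n n) (x∈p⇒∣p-x∣<∣p∣ {p = ⊤} (∈⊤ {x = v}))

module Star {n : ℕ} (v : Fin n) (S : Subset n) (v∉S : v ∉ S) where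

  leafAdj : Fin n → Fin n → Bool
  leafAdj i j = (does (i ≟ v) ∧ lookup S j) ∨ (does (j ≟ v) ∧ lookup S i)

  v-outside : lookup S v ≡ false
  v-outside = ¬-not (v∉S ∘ lookup⇒[]= v S)

  leafAdj-irrefl : ∀ i → leafAdj i i ≡ false
  leafAdj-irrefl i with i ≟ v
  ... | yes refl rewrite v-outside = refl
  ... | no  _    = refl

  star : SimpleGraph n
  star = record
    { adj    = leafAdj
    ; sym    = λ i j → ∨-comm (does (i ≟ v) ∧ lookup S j) (does (j ≟ v) ∧ lookup S i)
    ; irrefl = leafAdj-irrefl }

  centred : ∀ i j → adj star i j ≡ true → i ≡ v ⊎ j ≡ v
  centred i j ij with i ≟ v | j ≟ v
  ... | yes i≡v | _       = inj₁ i≡v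
  ... | no  _   | yes j≡v = inj₂ j≡v
  ... | no  _   | no  _   with ij
  ...   | ()

  adj-centre : ∀ j → adj star v j ≡ lookup S j
  adj-centre j with v ≟ v
  ... | no  v≢v = contradiction refl v≢v
  ... | yes _   rewrite v-outside | ∧-zeroʳ (does (j ≟ v)) = ∨-identityʳ (lookup S j)

  N-centre : N star v ≡ S
  N-centre = trans (tabulate-cong adj-centre) (tabulate∘lookup S)

  edgeCount-star≡∣S∣ : edgeCount star ≡ ∣ S ∣
  edgeCount-star≡∣S∣ = trans (edgeCount-star star v centred) (cong ∣_∣ N-centre)

  leaf∈S : ∀ {j} → adj star v j ≡ true → j ∈ S
  leaf∈S {j} vj = lookup⇒[]= j S (trans (sym (adj-centre j)) vj)

  star-in-complement : (G : SimpleGraph n) → (∀ j → j ∈ S → adj G v j ≡ false) →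
    InComplement G star
  star-in-complement G nonadjacent i j ij with centred i j ij
  ... | inj₁ refl = nonadjacent j (leaf∈S ij)
  ... | inj₂ refl = trans (adj-sym G i v) (nonadjacent i (leaf∈S (trans (adj-sym star v i) ij)))

reinforcement-lower-bound : ∀ {n} (G B : SimpleGraph n) {p d} (D : Subset n) x →
  (∀ y → deg G y ≤ d) → IsPDominating (G +E B) p D → x ∉ D → p ≤ d + edgeCount B
reinforcement-lower-bound G B {p} {d} D x maxDeg dominating x∉D = begin
  p                          ≤⟨ dominating x x∉D ⟩
  ∣ D ∩ N (G +E B) x ∣       ≤⟨ ∣p∩q∣≤∣q∣ D (N (G +E B) x) ⟩
  deg (G +E B) x             ≤⟨ deg-+E G B x ⟩
  deg G x + deg B x          ≤⟨ +-mono-≤ (maxDeg x) (deg≤edgeCount B x) ⟩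
  d + edgeCount B            ∎
  where open ≤-Reasoning

reinforcing-star : ∀ {n} (G : SimpleGraph n) {p} v k → deg G v + k < n → p ≤ deg G v + k →
  ∃[ B ] InComplement G B × edgeCount B ≡ k × IsPDominating (G +E B) p (⊤ - v)
reinforcing-star {n} G {p} v k fits reaches =
  star , star-in-complement G nonadjacent , trans edgeCount-star≡∣S∣ ∣S∣≡k ,
  punctured-dominating (G +E star) v newDegree
  where
  closed : Subset n
  closed = N G v ∪ ⁅ v ⁆
  enough : k ≤ ∣ ∁ closed ∣
  enough = subst (k ≤_) (sym (∣∁p∣≡n∸∣p∣ closed)) (m+n≤o⇒m≤o∸n k (begin
    k + ∣ closed ∣          ≤⟨ +-monoʳ-≤ k (∣p∪q∣≤∣p∣+∣q∣ (N G v) ⁅ v ⁆) ⟩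
    k + (deg G v + ∣ ⁅ v ⁆ ∣) ≡⟨ cong (λ c → k + (deg G v + c)) (∣⁅x⁆∣≡1 v) ⟩
    k + (deg G v + 1)       ≡⟨ cong (k +_) (+-comm (deg G v) 1) ⟩
    k + suc (deg G v)       ≡⟨ +-suc k (deg G v) ⟩
    suc (k + deg G v)       ≡⟨ cong suc (+-comm k (deg G v)) ⟩
    suc (deg G v + k)       ≤⟨ fits ⟩
    n                       ∎))
    where open ≤-Reasoning
  chosen = subset-of-size k (∁ closed) enough
  S = proj₁ chosen
  S-outside : ∀ {j} → j ∈ S → j ∉ closed
  S-outside j∈S = x∈∁p⇒x∉p (proj₁ (proj₂ chosen) j∈S)
  ∣S∣≡k : ∣ S ∣ ≡ k
  ∣S∣≡k = proj₂ (proj₂ chosen)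
  v∉S : v ∉ S
  v∉S v∈S = S-outside v∈S (x∈p∪q⁺ (inj₂ (x∈⁅x⁆ v)))
  open Star v S v∉S
  nonadjacent : ∀ j → j ∈ S → adj G v j ≡ false
  nonadjacent j j∈S = ∉N⇒nonadjacent G (S-outside j∈S ∘ x∈p∪q⁺ ∘ inj₁)
  disjoint : Empty (N G v ∩ S)
  disjoint (j , j∈N∩S) with x∈p∩q⁻ (N G v) S j∈N∩S
  ... | j∈N , j∈S = S-outside j∈S (x∈p∪q⁺ (inj₁ j∈N))
  newDegree : p ≤ deg (G +E star) v
  newDegree = begin
    p                           ≤⟨ reaches ⟩
    deg G v + k                 ≡⟨ cong (deg G v +_) (sym ∣S∣≡k) ⟩
    deg G v + ∣ S ∣             ≡⟨ sym (∣p∪q∣≡∣p∣+∣q∣ (N G v) S disjoint) ⟩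
    ∣ N G v ∪ S ∣               ≡⟨ cong (λ U → ∣ N G v ∪ U ∣) (sym N-centre) ⟩
    ∣ N G v ∪ N star v ∣        ≡⟨ cong ∣_∣ (sym (N-+E G star v)) ⟩
    deg (G +E star) v           ∎
    where open ≤-Reasoning

corollary2p2 : (p : ℕ) → 1 ≤ p → {n : ℕ} → (G : SimpleGraph n) → HasEdge G →
    (g : ℕ) → IsGammaP G p g → p < g →
    (Δ : ℕ) → IsMaxDegree G Δ → Δ < p →
    IsReinforcementP G p (p ∸ Δ)
corollary2p2 p _ {n} G _ g γG p<g Δ ((v , degv≡Δ) , maxDeg) Δ<p = upper , lower
  where
  g≡n : g ≡ n
  g≡n = γ-low-degree G (λ x → ≤-<-trans (maxDeg x) Δ<p) γG
  Δ+[p∸Δ]≡p : deg G v + (p ∸ Δ) ≡ p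
  Δ+[p∸Δ]≡p = trans (cong (_+ (p ∸ Δ)) degv≡Δ) (m+[n∸m]≡n (<⇒≤ Δ<p))
  upper : ∃[ B ] InComplement G B × ReducesGammaP G p B × edgeCount B ≡ p ∸ Δ
  upper with reinforcing-star G v (p ∸ Δ) (subst₂ _<_ (sym Δ+[p∸Δ]≡p) g≡n p<g) (≤-reflexive (sym Δ+[p∸Δ]≡p))
  ... | B , B⊆Gᶜ , edges , dominating with γ-exists (G +E B) p
  ...   | g′ , γB = B , B⊆Gᶜ , (g , g′ , γG , γB , g′<g) , edges
    where
    g′<g : g′ < g
    g′<g = subst (g′ <_) (sym g≡n) (≤-<-trans (proj₂ γB (⊤ - v) dominating) (∣⊤-v∣<n v))
  lower : ∀ B → InComplement G B → ReducesGammaP G p B → p ∸ Δ ≤ edgeCount B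
  lower B _ (g₁ , g₂ , γ₁ , ((D , dominating , ∣D∣≡g₂) , _) , g₂<g₁)
    with missing-vertex D (subst (_< n) (sym ∣D∣≡g₂) (<-≤-trans g₂<g₁ (γ≤n G γ₁)))
  ... | x , x∉D = m≤n+o⇒m∸n≤o p Δ (reinforcement-lower-bound G B D x maxDeg dominating x∉D)
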